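{- Let $\psi$ be an $\mathrm{FO}^3(<,\mathrm{succ},\mathrm{min},\mathrm{max})$-formula, let $A$ and $B$ be sets of interpretations such that every interpretation in $A$ satisfies $\psi$ and every interpretation in $B$ satisfies $\neg\psi$, and let $\delta$ be a minimal separator for $\langle A,B\rangle$. Then $|\psi|\ge \tfrac12\, w(\delta)$.
   Context: For $N\in\mathbb{N}$, $\mathcal{A}_N$ is the structure with universe $\{0,\dots,N\}$, $<$ the natural order, $\mathrm{succ}=\{(a,a+1)\}$, $\mathrm{min}=0$, $\mathrm{max}=N$. $\mathrm{FO}^3(<,\mathrm{succ},\mathrm{min},\mathrm{max})$ consists of first-order formulas over this signature using only the variables $x,y,z$ (built from atoms $R(u,u')$ with $R\in\{<,=,\mathrm{succ}\}$, $u,u'\in\{\mathrm{min},\mathrm{max},x,y,z\}$ by $\neg,\vee,\wedge,\exists,\forall$). The size $|\psi|$ is the number of nodes of the syntax tree. An interpretation is a pair $(\mathcal{A},\alpha)$ with $\mathcal{A}=\mathcal{A}_N$ for some $N$ and $\alpha\colon\{x,y,z\}\to\{0,\dots,N\}$, extended by $\alpha(\mathrm{min})=0$, $\alpha(\mathrm{max})=N$. Let $\mathrm{diff}(m,n)=m-n$ and $<\!\text{ -type}(m,n)\in\{<,=,>\}$ be the order relation between $m$ and $n$. Let $\mathcal{P}_2(S)$ be the set of 2-element subsets of $S$. A potential separator is a map $\delta\colon\mathcal{P}_2(\{\mathrm{min},\mathrm{max},x,y,z\})\to\mathbb{N}$. It is a separator for $\langle A,B\rangle$ if for every $(\mathcal{A},\alpha)\in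 A$ and $(\mathcal{B},\beta)\in B$ there are distinct $u,u'\in\{\mathrm{min},\mathrm{max},x,y,z\}$ with $\delta(\{u,u'\})\ge1$ and either (1) $<\!\text{ -type}(\alpha(u),\alpha(u'))\ne<\!\text{ -type}(\beta(u),\beta(u'))$, or (2) $\delta(\{u,u'\})\ge\min\{|\mathrm{diff}(\alpha(u),\alpha(u'))|,|\mathrm{diff}(\beta(u),\beta(u'))|\}$ and $\mathrm{diff}(\alpha(u),\alpha(u'))\ne\mathrm{diff}(\beta(u),\beta(u'))$. Define $b(\delta)=\max\{\delta(\{\mathrm{min},\mathrm{max}\}),\ \delta(\{\mathrm{min},u\})+\delta(\{u',\mathrm{max}\}) : u,u'\in\{x,y,z\}\}$, $c(\delta)=\max\{\delta(p)+\delta(q): p,q\in\mathcal{P}_2(\{x,y,z\}), p\ne q\}$, and the weight $w(\delta)=\sqrt{c(\delta)^2+b(\delta)}$. A minimal separator for $\langle A,B\rangle$ is a separator for $\langle A,B\rangle$ whose weight is minimal among all separators for $\langle A,B\rangle$. -}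

module Defs where

open import Data.Nat using (ℕ; zero; suc; _+_; _*_; _≤_; _⊔_; _⊓_)
open import Data.Integer as ℤ using (ℤ; +_; ∣_∣)
open import Data.Bool using (Bool; true; false; not; _∧_; _∨_)
open import Data.List using (List; upTo)
open import Data.Bool.ListAction using (any; all)
open import Data.Product using (Σ; _×_; _,_)
open import Data.Sum using (_⊎_)
open import Relation.Binary.PropositionalEquality using (_≡_; _≢_)
open import Relation.Nullary using (does)

data Var : Set where
  x y z : Var

data Term : Set where
  tmin tmax : Term
  var : Var → Term

data Rel : Set where
  lt eq succ : Rel

data Formula : Set where
  atom : Rel → Term → Term → Formula
  ¬'_ : Formula → Formula
  _∨'_ _∧'_ : Formula → Formula → Formula
  ∃' ∀' : Var → Formula → Formula

size : Formula → ℕ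
size (atom _ _ _) = 1
size (¬' φ) = suc (size φ)
size (φ ∨' ψ) = suc (size φ + size ψ)
size (φ ∧' ψ) = suc (size φ + size ψ)
size (∃' _ φ) = suc (size φ)
size (∀' _ φ) = suc (size φ)

Assignment : Set
Assignment = Var → ℕ

_≟V_ : Var → Var → Bool
x ≟V x = true
y ≟V y = true
z ≟V z = true
_ ≟V _ = false

update : Assignment → Var → ℕ → Assignment
update α v n w with v ≟V w
... | true = n
... | false = α w

val : ℕ → Assignment → Term → ℕ
val N α tmin = 0
val N α tmax = N
val N α (var v) = α v

relB : Rel → ℕ → ℕ → Bool
relB lt m n = does (suc m Data.Nat.≤? n)
relB eq m n = does (m Data.Nat.≟ n)
relB succ m n = does (suc m Data.Nat.≟ n)

eval : ℕ → Assignment → Formula → Bool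
eval N α (atom R u u') = relB R (val N α u) (val N α u')
eval N α (¬' φ) = not (eval N α φ)
eval N α (φ ∨' ψ) = eval N α φ ∨ eval N α ψ
eval N α (φ ∧' ψ) = eval N α φ ∧ eval N α ψ
eval N α (∃' v φ) = any (λ n → eval N (update α v n) φ) (upTo (suc N))
eval N α (∀' v φ) = all (λ n → eval N (update α v n) φ) (upTo (suc N))

-- an interpretation (𝒜_N, α) with α : {x,y,z} → {0,…,N}
record Interp : Set where
  constructor mkInterp
  field
    N : ℕ
    α : Assignment
    α≤N : ∀ v → α v ≤ N

open Interp public

_⊨_ : Interp → Formula → Bool
I ⊨ φ = eval (N I) (α I) φ

valI : Interp → Term → ℕ
valI I = val (N I) (α I)

-- the 10 two-element subsets of {min,max,x,y,z}
data Pair : Set where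
  p-min-max p-min-x p-min-y p-min-z p-max-x p-max-y p-max-z p-x-y p-x-z p-y-z : Pair

fstP sndP : Pair → Term
fstP p-min-max = tmin
fstP p-min-x = tmin
fstP p-min-y = tmin
fstP p-min-z = tmin
fstP p-max-x = tmax
fstP p-max-y = tmax
fstP p-max-z = tmax
fstP p-x-y = var x
fstP p-x-z = var x
fstP p-y-z = var y
sndP p-min-max = tmax
sndP p-min-x = var x
sndP p-min-y = var y
sndP p-min-z = var z
sndP p-max-x = var x
sndP p-max-y = var y
sndP p-max-z = var z
sndP p-x-y = var y
sndP p-x-z = var z
sndP p-y-z = var z

PotSep : Set
PotSep = Pair → ℕ

data OrdType : Set where
  lt eq gt : OrdType

ordType : ℕ → ℕ → OrdType
ordType zero zero = eq
ordType zero (suc _) = lt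
ordType (suc _) zero = gt
ordType (suc m) (suc n) = ordType m n

diff : ℕ → ℕ → ℤ
diff m n = (+ m) ℤ.- (+ n)

Distinguishes : PotSep → Interp → Interp → Pair → Set
Distinguishes δ I J p =
  1 ≤ δ p ×
  ( ordType (valI I u) (valI I u') ≢ ordType (valI J u) (valI J u')
  ⊎ ( ∣ diff (valI I u) (valI I u') ∣ ⊓ ∣ diff (valI J u) (valI J u') ∣ ≤ δ p
    × diff (valI I u) (valI I u') ≢ diff (valI J u) (valI J u') ) )
  where
  u = fstP p
  u' = sndP p

IsSeparator : (A B : Interp → Set) → PotSep → Set
IsSeparator A B δ = ∀ I J → A I → B J → Σ Pair (Distinguishes δ I J)

minP : Var → Pair
minP x = p-min-x
minP y = p-min-y
minP z = p-min-z

maxP : Var → Pair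
maxP x = p-max-x
maxP y = p-max-y
maxP z = p-max-z

-- max over u,u' ∈ {x,y,z} of δ{min,u} + δ{u',max}
bMinMax : PotSep → ℕ
bMinMax δ = (δ (minP x) ⊔ δ (minP y) ⊔ δ (minP z)) + (δ (maxP x) ⊔ δ (maxP y) ⊔ δ (maxP z))

b : PotSep → ℕ
b δ = δ p-min-max ⊔ bMinMax δ

c : PotSep → ℕ
c δ = (δ p-x-y + δ p-x-z) ⊔ (δ p-x-y + δ p-y-z) ⊔ (δ p-x-z + δ p-y-z)

-- square of the weight: w(δ)² = c(δ)² + b(δ)
weight² : PotSep → ℕ
weight² δ = c δ * c δ + b δ

-- since w = √(weight²) is monotone, comparing weights = comparing weight²
IsMinimalSeparator : (A B : Interp → Set) → PotSep → Set
IsMinimalSeparator A B δ =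
  IsSeparator A B δ × (∀ δ' → IsSeparator A B δ' → weight² δ ≤ weight² δ')

module Submission where

-- To every formula φ we attach a potential separator sepOf φ: an atom contributes the
-- pair of its terms, ¬ is transparent, ∨ and ∧ add pointwise, and a quantifier on v
-- drops the pairs through v and raises every other threshold δ{w,w'} to at least
-- δ{w,v} + δ{w',v} + 1. Two interpretations are δ-similar when, for every pair {w,w'}
-- with δ{w,w'} ≥ 1, the displacements w − w' are equal or both beyond δ{w,w'} on the
-- same side. An Ehrenfeucht–Fraïssé argument shows that sepOf φ-similar
-- interpretations agree on φ: the raised thresholds leave room to answer any choice
-- for v, either by copying its offset from a nearby point or by placing it in the
-- matching gap. As no pair distinguishes similar interpretations, sepOf ψ separates
-- ⟨A,B⟩; by minimality w(δ)² ≤ c² + b for c = c(sepOf ψ) ≤ |ψ| and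
-- b = b(sepOf ψ) ≤ 2|ψ|², hence w(δ)² ≤ 3|ψ|² ≤ (2|ψ|)².

open import Defs
open import Data.Nat as ℕ using (ℕ; zero; suc; z≤n; s≤s)
import Data.Nat.Properties as ℕ
open import Data.Nat.Tactic.RingSolver using (solve-∀)
open import Algebra.Properties.CommutativeSemigroup ℕ.+-commutativeSemigroup using (interchange)
open import Data.Integer as ℤ using (ℤ; +_; +≤+; ∣_∣)
import Data.Integer.Properties as ℤ
open import Data.Bool using (Bool; true; false; T; not; _∨_; _∧_)
open import Data.Bool.ListAction using (any; all)
open import Data.List using (List; []; _∷_; map; filter; upTo)
open import Data.List.Membership.Propositional using (_∈_; find; lose)
open import Data.List.Membership.Propositional.Properties using (∈-map⁺; ∈-filter⁺; ∈-filter⁻; ∈-upTo⁺; ∈-upTo⁻)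
open import Data.List.Relation.Unary.Any using (here; there; any?)
import Data.List.Relation.Unary.Any.Properties as Any
open import Data.List.Relation.Unary.All as All using (all?)
import Data.List.Relation.Unary.All.Properties as All
open import Data.Product using (∃-syntax; Σ; _×_; _,_; proj₁; proj₂; uncurry)
open import Data.Sum using (_⊎_; inj₁; inj₂)
open import Data.Empty using (⊥-elim)
open import Relation.Nullary using (¬_; Dec; yes; no; ¬?; _×-dec_; _⊎-dec_)
open import Relation.Nullary.Decidable using (map′; True; toWitness)
open import Relation.Binary using (DecidableEquality)
open import Relation.Binary.PropositionalEquality

module Displacement where

  open import Data.Integer using (+[1+_]; -[1+_]; _⊖_; 0ℤ; _+_; _-_; -_; _<_; _≤_; _≤?_; +<+; -<-; -<+)
  open import Data.Integer.Properties
    using (≤-trans; <-trans; neg-mono-<; neg-mono-≤; neg-≤-pos; neg-involutive; ≤-<-trans; <-≤-trans; <⇒≤; <-irrefl)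
  import Data.Integer.Tactic.RingSolver as ℤ-Ring
  open import Data.List.Extrema ℤ.≤-totalOrder using (max; v≤max⁺; max<v⁺)

  data Agree (t : ℕ) : ℤ → ℤ → Set where
    same  : ∀ {d} → Agree t d d
    above : ∀ {d e} → + t < d → + t < e → Agree t d e
    below : ∀ {d e} → d < - + t → e < - + t → Agree t d e

  module _ {t : ℕ} where

    Agree-sym : ∀ {d e} → Agree t d e → Agree t e d
    Agree-sym same        = same
    Agree-sym (above p q) = above q p
    Agree-sym (below p q) = below q p

    Agree-neg : ∀ {d e} → Agree t d e → Agree t (- d) (- e)
    Agree-neg same        = same
    Agree-neg (above p q) = below (neg-mono-< p) (neg-mono-< q)
    Agree-neg (below p q) = above (flip p) (flip q)
      where
      flip : ∀ {d} → d < - + t → + t < - d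
      flip {d} p = subst (_< - d) (neg-involutive (+ t)) (neg-mono-< p)

    Agree-mono : ∀ {t' d e} → t ℕ.≤ t' → Agree t' d e → Agree t d e
    Agree-mono t≤t' same        = same
    Agree-mono t≤t' (above p q) = above (≤-<-trans (+≤+ t≤t') p) (≤-<-trans (+≤+ t≤t') q)
    Agree-mono {t'} t≤t' (below p q) = below (<-≤-trans p -t'≤-t) (<-≤-trans q -t'≤-t)
      where
      -t'≤-t : - + t' ≤ - + t
      -t'≤-t = neg-mono-≤ (+≤+ t≤t')

    Agree-shift : ∀ {s d e r} → Agree (t ℕ.+ s) d e → - + s ≤ r → r ≤ + s → Agree t (d + r) (e + r)
    Agree-shift same            -s≤r r≤s = same
    Agree-shift {s} (above p q) -s≤r r≤s = above (shift p) (shift q)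
      where
      cancel : ∀ i j → i + j + - j ≡ i
      cancel = ℤ-Ring.solve-∀
      shift : ∀ {d} → + (t ℕ.+ s) < d → + t < d + _
      shift p = subst (_< _) (trans (cong (_+ - + s) (ℤ.pos-+ t s)) (cancel (+ t) (+ s))) (ℤ.+-mono-<-≤ p -s≤r)
    Agree-shift {s} (below p q) -s≤r r≤s = below (shift p) (shift q)
      where
      cancel : ∀ i j → - (i + j) + j ≡ - i
      cancel = ℤ-Ring.solve-∀
      shift : ∀ {d} → d < - + (t ℕ.+ s) → d + _ < - + t
      shift p = subst (_ <_) (trans (cong (λ i → - i + + s) (ℤ.pos-+ t s)) (cancel (+ t) (+ s))) (ℤ.+-mono-<-≤ p r≤s)

    Agree-nonneg : ∀ {d e} → Agree t d e → 0ℤ ≤ d → 0ℤ ≤ e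
    Agree-nonneg same        0≤d = 0≤d
    Agree-nonneg (above p q) 0≤d = ≤-trans (+≤+ z≤n) (<⇒≤ q)
    Agree-nonneg (below p q) 0≤d = ⊥-elim (<-irrefl refl (<-≤-trans (≤-<-trans 0≤d p) neg-≤-pos))

    Agree-nonpos : ∀ {d e} → Agree t d e → d ≤ 0ℤ → e ≤ 0ℤ
    Agree-nonpos same        d≤0 = d≤0
    Agree-nonpos (above p q) d≤0 = ⊥-elim (<-irrefl refl (≤-<-trans (+≤+ z≤n) (<-≤-trans p d≤0)))
    Agree-nonpos (below p q) d≤0 = ≤-trans (<⇒≤ q) neg-≤-pos

    Agree-above : ∀ {d e} → Agree t d e → + t < d → + t < e
    Agree-above same        t<d = t<d
    Agree-above (above p q) t<d = q
    Agree-above (below p q) t<d = ⊥-elim (<-irrefl refl (<-trans t<d (<-≤-trans p neg-≤-pos)))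

  Agree-self : ∀ t m n → Agree t (diff m m) (diff n n)
  Agree-self t m n = subst₂ (Agree t) (sym (ℤ.+-inverseʳ (+ m))) (sym (ℤ.+-inverseʳ (+ n))) same

  Agree-swap : ∀ {t} m n m' n' → Agree t (diff m n) (diff m' n') → Agree t (diff n m) (diff n' m')
  Agree-swap m n m' n' a = subst₂ (Agree _) (neg-sub (+ m) (+ n)) (neg-sub (+ m') (+ n')) (Agree-neg a)
    where
    neg-sub : ∀ i j → - (i - j) ≡ j - i
    neg-sub = ℤ-Ring.solve-∀

  relOfDiff : Rel → ℤ → Bool
  relOfDiff lt   -[1+ _ ]    = true
  relOfDiff lt   (+ _)       = false
  relOfDiff eq   (+ zero)    = true
  relOfDiff eq   _           = false
  relOfDiff succ -[1+ zero ] = true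
  relOfDiff succ _           = false

  relB≡relOfDiff-⊖ : ∀ R m n → relB R m n ≡ relOfDiff R (m ⊖ n)
  relB≡relOfDiff-⊖ lt   zero    zero          = refl
  relB≡relOfDiff-⊖ eq   zero    zero          = refl
  relB≡relOfDiff-⊖ succ zero    zero          = refl
  relB≡relOfDiff-⊖ lt   zero    (suc n)       = refl
  relB≡relOfDiff-⊖ eq   zero    (suc n)       = refl
  relB≡relOfDiff-⊖ succ zero    (suc zero)    = refl
  relB≡relOfDiff-⊖ succ zero    (suc (suc n)) = refl
  relB≡relOfDiff-⊖ lt   (suc m) zero          = refl
  relB≡relOfDiff-⊖ eq   (suc m) zero          = refl
  relB≡relOfDiff-⊖ succ (suc m) zero          = refl
  relB≡relOfDiff-⊖ R    (suc m) (suc n)       = begin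
    relB R (suc m) (suc n)       ≡⟨ relB-suc R ⟩
    relB R m n                   ≡⟨ relB≡relOfDiff-⊖ R m n ⟩
    relOfDiff R (m ⊖ n)          ≡⟨ cong (relOfDiff R) (ℤ.[1+m]⊖[1+n]≡m⊖n m n) ⟨
    relOfDiff R (suc m ⊖ suc n)  ∎
    where
    open ≡-Reasoning
    relB-suc : ∀ R → relB R (suc m) (suc n) ≡ relB R m n
    relB-suc lt   = refl
    relB-suc eq   = refl
    relB-suc succ = refl

  relOfDiff-agree : ∀ R {d e} → Agree 1 d e → relOfDiff R d ≡ relOfDiff R e
  relOfDiff-agree R same        = refl
  relOfDiff-agree R (above p q) = trans (above-two R p) (sym (above-two R q))
    where
    above-two : ∀ R {d} → + 1 < d → relOfDiff R d ≡ relOfDiff R (+ 2)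
    above-two lt   (+<+ (s≤s (s≤s _))) = refl
    above-two eq   (+<+ (s≤s (s≤s _))) = refl
    above-two succ (+<+ (s≤s (s≤s _))) = refl
  relOfDiff-agree R (below p q) = trans (below-two R p) (sym (below-two R q))
    where
    below-two : ∀ R {d} → d < - + 1 → relOfDiff R d ≡ relOfDiff R -[1+ 1 ]
    below-two lt   (-<- (s≤s z≤n)) = refl
    below-two eq   (-<- (s≤s z≤n)) = refl
    below-two succ (-<- (s≤s z≤n)) = refl

  relB≡relOfDiff : ∀ R m n → relB R m n ≡ relOfDiff R (diff m n)
  relB≡relOfDiff R m n = trans (relB≡relOfDiff-⊖ R m n) (cong (relOfDiff R) (sym (ℤ.[+m]-[+n]≡m⊖n m n)))

  relB-agree : ∀ R {m n m' n'} → Agree 1 (diff m n) (diff m' n') → relB R m n ≡ relB R m' n'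
  relB-agree R {m} {n} {m'} {n'} a =
    trans (relB≡relOfDiff R m n) (trans (relOfDiff-agree R a) (sym (relB≡relOfDiff R m' n')))

  signType : ℤ → OrdType
  signType (+ zero)  = eq
  signType +[1+ _ ]  = gt
  signType -[1+ _ ]  = lt

  ordType≡signType-⊖ : ∀ m n → ordType m n ≡ signType (m ⊖ n)
  ordType≡signType-⊖ zero    zero    = refl
  ordType≡signType-⊖ zero    (suc n) = refl
  ordType≡signType-⊖ (suc m) zero    = refl
  ordType≡signType-⊖ (suc m) (suc n) = trans (ordType≡signType-⊖ m n) (cong signType (sym (ℤ.[1+m]⊖[1+n]≡m⊖n m n)))

  ordType≡signType : ∀ m n → ordType m n ≡ signType (diff m n)
  ordType≡signType m n = trans (ordType≡signType-⊖ m n) (cong signType (sym (ℤ.[+m]-[+n]≡m⊖n m n)))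

  far⇒Agree : ∀ {t d e} → t ℕ.< ∣ d ∣ → t ℕ.< ∣ e ∣ → signType d ≡ signType e → Agree t d e
  far⇒Agree {d = + zero}              ()
  far⇒Agree {e = + zero}              _ ()
  far⇒Agree {d = +[1+ _ ]} {+[1+ _ ]} p q _ = above (+<+ p) (+<+ q)
  far⇒Agree {d = +[1+ _ ]} { -[1+ _ ]} _ _ ()
  far⇒Agree {d = -[1+ _ ]} {+[1+ _ ]} _ _ ()
  far⇒Agree {d = -[1+ _ ]} { -[1+ _ ]} p q _ = below (below-neg p) (below-neg q)
    where
    below-neg : ∀ {t k} → t ℕ.< suc k → -[1+ k ] < - + t
    below-neg {zero}  _       = -<+
    below-neg {suc t} (s≤s p) = -<- p

  _≟O_ : DecidableEquality OrdType
  lt ≟O lt = yes refl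
  lt ≟O eq = no λ ()
  lt ≟O gt = no λ ()
  eq ≟O lt = no λ ()
  eq ≟O eq = yes refl
  eq ≟O gt = no λ ()
  gt ≟O lt = no λ ()
  gt ≟O eq = no λ ()
  gt ≟O gt = yes refl

  Separated : ℕ → ℕ → ℕ → ℕ → ℕ → Set
  Separated t m n m' n' =
    ordType m n ≢ ordType m' n' ⊎ (∣ diff m n ∣ ℕ.⊓ ∣ diff m' n' ∣ ℕ.≤ t × diff m n ≢ diff m' n')

  Separated? : ∀ t m n m' n' → Dec (Separated t m n m' n')
  Separated? t m n m' n' =
    ¬? (ordType m n ≟O ordType m' n')
      ⊎-dec ((∣ diff m n ∣ ℕ.⊓ ∣ diff m' n' ∣ ℕ.≤? t) ×-dec ¬? (diff m n ℤ.≟ diff m' n'))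

  Agree-unless-separated : ∀ t m n m' n' → ¬ Separated t m n m' n' → Agree t (diff m n) (diff m' n')
  Agree-unless-separated t m n m' n' ¬sep with ordType m n ≟O ordType m' n'
  ... | no  o≢o' = ⊥-elim (¬sep (inj₁ o≢o'))
  ... | yes o≡o' with diff m n ℤ.≟ diff m' n'
  ...   | yes d≡d' = subst (Agree t (diff m n)) d≡d' same
  ...   | no  d≢d' with ∣ diff m n ∣ ℕ.⊓ ∣ diff m' n' ∣ ℕ.≤? t
  ...     | yes close = ⊥-elim (¬sep (inj₂ (close , d≢d')))
  ...     | no  far   = far⇒Agree (ℕ.<-≤-trans (ℕ.≰⇒> far) (ℕ.m⊓n≤m _ _))
                                    (ℕ.<-≤-trans (ℕ.≰⇒> far) (ℕ.m⊓n≤n _ _))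
                          (trans (sym (ordType≡signType m n)) (trans o≡o' (ordType≡signType m' n')))

  private
    +<⇒<- : ∀ {i j k} → i + k < j → i < j - k
    +<⇒<- {i} {j} {k} p = subst (_< j - k) (cancel i k) (ℤ.+-monoˡ-< (- k) p)
      where
      cancel : ∀ i k → i + k - k ≡ i
      cancel = ℤ-Ring.solve-∀

    <-⇒+< : ∀ {i j k} → i < j - k → i + k < j
    <-⇒+< {i} {j} {k} p = subst (i + k <_) (cancel j k) (ℤ.+-monoˡ-< k p)
      where
      cancel : ∀ j k → j - k + k ≡ j
      cancel = ℤ-Ring.solve-∀

    <-‿swap : ∀ {i j k} → i < j - k → k < j - i
    <-‿swap {i} {j} {k} p = +<⇒<- (subst (_< j) (ℤ.+-comm i k) (<-⇒+< p))

    gap-sum : ∀ {s s' i j} → + s' < i → j < - + s → + suc (s' ℕ.+ s) < i - j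
    gap-sum {s} {s'} {i} {j} s'<i j<-s = ℤ.+-mono-≤-< (ℤ.i<j⇒suc[i]≤j s'<i) s<-j
      where
      s<-j : + s < - j
      s<-j = subst (_< - j) (neg-involutive (+ s)) (neg-mono-< j<-s)

  -- If a lies within s w of some A w, q copies that offset. Otherwise a sits in a gap
  -- between left and right points, and the + 1 in the hypothesis keeps the matching
  -- gap among the B w wide enough to put q just right of all left points.
  module OnePointExtension
    {Ix : Set} (A B : Ix → ℤ) (s : Ix → ℕ) (ws : List Ix)
    (agree : ∀ {w w'} → w ∈ ws → w' ∈ ws → Agree (suc (s w ℕ.+ s w')) (A w - A w') (B w - B w'))
    (a : ℤ) {w₀ : Ix} (w₀∈ws : w₀ ∈ ws) (A[w₀]≤a : A w₀ ≤ a)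
    where

    Close : Ix → Set
    Close w = - + s w ≤ A w - a × A w - a ≤ + s w

    Left Right : Ix → Set
    Left w  = A w - a < - + s w
    Right w = + s w < A w - a

    Extension : ℤ → Set
    Extension q = ∀ {w} → w ∈ ws → Agree (s w) (A w - a) (B w - q)

    extension-near : ∀ {w} → w ∈ ws → Close w → Extension (B w - (A w - a))
    extension-near {w} w∈ws (-s≤r , r≤s) {w'} w'∈ws =
      subst₂ (Agree (s w')) (ℤ.+-minus-telescope (A w') (A w) a) B-telescope
        (Agree-shift (Agree-mono (ℕ.n≤1+n _) (agree w'∈ws w∈ws)) -s≤r r≤s)
      where
      B-telescope : B w' - B w + (A w - a) ≡ B w' - (B w - (A w - a))
      B-telescope = begin
        B w' - B w + (A w - a)                ≡⟨ cong (λ r → B w' - B w + r) (sub-sub (B w) (A w - a)) ⟨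
        B w' - B w + (B w - (B w - (A w - a))) ≡⟨ ℤ.+-minus-telescope (B w') (B w) _ ⟩
        B w' - (B w - (A w - a))              ∎
        where
        open ≡-Reasoning
        sub-sub : ∀ i r → i - (i - r) ≡ r
        sub-sub = ℤ-Ring.solve-∀

    Close? : ∀ w → Dec (Close w)
    Close? w = (- + s w ≤? A w - a) ×-dec (A w - a ≤? + s w)

    Left? : ∀ w → Dec (Left w)
    Left? w = A w - a ℤ.<? - + s w

    module Gap (far : ∀ {w} → w ∈ ws → ¬ Close w) where

      left-or-right : ∀ {w} → w ∈ ws → Left w ⊎ Right w
      left-or-right {w} w∈ws with - + s w ≤? A w - a
      ... | no  -s≰r = inj₁ (ℤ.≰⇒> -s≰r)
      ... | yes -s≤r = inj₂ (ℤ.≰⇒> (λ r≤s → far w∈ws (-s≤r , r≤s)))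

      left-w₀ : Left w₀
      left-w₀ with left-or-right w₀∈ws
      ... | inj₁ l = l
      ... | inj₂ r = ⊥-elim (ℤ.<⇒≱ (ℤ.<-≤-trans r (ℤ.i≤j⇒i-j≤0 A[w₀]≤a)) (+≤+ ℕ.z≤n))

      bound : Ix → ℤ
      bound w = B w + + suc (s w)

      q : ℤ
      q = max (bound w₀) (map bound (filter Left? ws))

      bound≤q : ∀ {w} → w ∈ ws → Left w → bound w ≤ q
      bound≤q {w} w∈ws l =
        v≤max⁺ (bound w₀) _ (inj₂ (lose (∈-map⁺ bound (∈-filter⁺ Left? w∈ws l)) ℤ.≤-refl))

      bound<right : ∀ {w w'} → w ∈ ws → w' ∈ ws → Left w → Right w' → bound w < B w' - + s w'
      bound<right {w} {w'} w∈ws w'∈ws l r = +<⇒<- (begin-strict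
        bound w + + s w'                ≡⟨ ℤ.+-assoc (B w) (+ suc (s w)) (+ s w') ⟩
        B w + + suc (s w ℕ.+ s w')      ≡⟨ cong (λ n → B w + + suc n) (ℕ.+-comm (s w) (s w')) ⟩
        B w + + suc (s w' ℕ.+ s w)      <⟨ ℤ.+-monoʳ-< (B w) B-gap ⟩
        B w + (B w' - B w)              ≡⟨ add-sub (B w) (B w') ⟩
        B w'                            ∎)
        where
        open ℤ.≤-Reasoning
        add-sub : ∀ i j → i + (j - i) ≡ j
        add-sub = ℤ-Ring.solve-∀
        sub-sub-sub : ∀ i j k → (i - k) - (j - k) ≡ i - j
        sub-sub-sub = ℤ-Ring.solve-∀
        A-gap : + suc (s w' ℕ.+ s w) < A w' - A w
        A-gap = subst (_ <_) (sub-sub-sub (A w') (A w) a) (gap-sum r l)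
        B-gap : + suc (s w' ℕ.+ s w) < B w' - B w
        B-gap = Agree-above (agree w'∈ws w∈ws) A-gap

      extension-far : Extension q
      extension-far {w} w∈ws with left-or-right w∈ws
      ... | inj₁ l = below l (ℤ.≤-<-trans B-q≤B-bound (subst (_< _) (sym (sub-add (B w) _)) -s-1<-s))
        where
        sub-add : ∀ i j → i - (i + j) ≡ - j
        sub-add = ℤ-Ring.solve-∀
        B-q≤B-bound : B w - q ≤ B w - bound w
        B-q≤B-bound = ℤ.+-monoʳ-≤ (B w) (ℤ.neg-mono-≤ (bound≤q w∈ws l))
        -s-1<-s : - + suc (s w) < - + s w
        -s-1<-s = ℤ.neg-mono-< (ℤ.+<+ (ℕ.n<1+n (s w)))
      ... | inj₂ r = above r (<-‿swap {q} {B w} q<B-s)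
        where
        q<B-s : q < B w - + s w
        q<B-s = uncurry ℤ.≤∧≢⇒< (max<v⁺ (asPair (bound<right w₀∈ws w∈ws left-w₀ r))
                  (All.map⁺ (All.tabulate λ w'∈ →
                    let w'∈ws , l' = ∈-filter⁻ Left? w'∈ in asPair (bound<right w'∈ws w∈ws l' r))))
          where
          asPair : ∀ {i j} → i < j → i ≤ j × i ≢ j
          asPair i<j = ℤ.<⇒≤ i<j , ℤ.<⇒≢ i<j

    extension : ∃[ q ] Extension q
    extension with any? Close? ws
    ... | yes close = let w , w∈ws , c = find close in _ , extension-near w∈ws c
    ... | no  none  = Gap.q far , Gap.extension-far far
      where
      far : ∀ {w} → w ∈ ws → ¬ Close w
      far w∈ws c = none (lose w∈ws c)

open Displacement
open import Data.Nat using (_+_; _*_; _≤_; _⊔_)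

termCode : Term → ℕ
termCode tmin    = 0
termCode tmax    = 1
termCode (var x) = 2
termCode (var y) = 3
termCode (var z) = 4

termDecode : ℕ → Term
termDecode 0 = tmin
termDecode 1 = tmax
termDecode 2 = var x
termDecode 3 = var y
termDecode _ = var z

termDecode-termCode : ∀ w → termDecode (termCode w) ≡ w
termDecode-termCode tmin    = refl
termDecode-termCode tmax    = refl
termDecode-termCode (var x) = refl
termDecode-termCode (var y) = refl
termDecode-termCode (var z) = refl

_≟T_ : DecidableEquality Term
w ≟T w' = map′ injective (cong termCode) (termCode w ℕ.≟ termCode w')
  where
  injective : termCode w ≡ termCode w' → w ≡ w'
  injective codes≡ = trans (sym (termDecode-termCode w)) (trans (cong termDecode codes≡) (termDecode-termCode w'))

allTerms : List Term
allTerms = tmin ∷ tmax ∷ var x ∷ var y ∷ var z ∷ []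

∈-allTerms : ∀ w → w ∈ allTerms
∈-allTerms tmin    = here refl
∈-allTerms tmax    = there (here refl)
∈-allTerms (var x) = there (there (here refl))
∈-allTerms (var y) = there (there (there (here refl)))
∈-allTerms (var z) = there (there (there (there (here refl))))

-- pairOf w w is a junk value; it is only used for w ≢ w'.
pairOf : Term → Term → Pair
pairOf tmin    tmin    = p-min-max
pairOf tmin    tmax    = p-min-max
pairOf tmin    (var x) = p-min-x
pairOf tmin    (var y) = p-min-y
pairOf tmin    (var z) = p-min-z
pairOf tmax    tmin    = p-min-max
pairOf tmax    tmax    = p-min-max
pairOf tmax    (var x) = p-max-x
pairOf tmax    (var y) = p-max-y
pairOf tmax    (var z) = p-max-z
pairOf (var x) tmin    = p-min-x
pairOf (var x) tmax    = p-max-x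
pairOf (var x) (var x) = p-min-max
pairOf (var x) (var y) = p-x-y
pairOf (var x) (var z) = p-x-z
pairOf (var y) tmin    = p-min-y
pairOf (var y) tmax    = p-max-y
pairOf (var y) (var x) = p-x-y
pairOf (var y) (var y) = p-min-max
pairOf (var y) (var z) = p-y-z
pairOf (var z) tmin    = p-min-z
pairOf (var z) tmax    = p-max-z
pairOf (var z) (var x) = p-x-z
pairOf (var z) (var y) = p-y-z
pairOf (var z) (var z) = p-min-max

pairOf-comm : ∀ w w' → pairOf w w' ≡ pairOf w' w
pairOf-comm tmin    tmin    = refl
pairOf-comm tmin    tmax    = refl
pairOf-comm tmin    (var x) = refl
pairOf-comm tmin    (var y) = refl
pairOf-comm tmin    (var z) = refl
pairOf-comm tmax    tmin    = refl
pairOf-comm tmax    tmax    = refl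
pairOf-comm tmax    (var x) = refl
pairOf-comm tmax    (var y) = refl
pairOf-comm tmax    (var z) = refl
pairOf-comm (var x) tmin    = refl
pairOf-comm (var x) tmax    = refl
pairOf-comm (var x) (var x) = refl
pairOf-comm (var x) (var y) = refl
pairOf-comm (var x) (var z) = refl
pairOf-comm (var y) tmin    = refl
pairOf-comm (var y) tmax    = refl
pairOf-comm (var y) (var x) = refl
pairOf-comm (var y) (var y) = refl
pairOf-comm (var y) (var z) = refl
pairOf-comm (var z) tmin    = refl
pairOf-comm (var z) tmax    = refl
pairOf-comm (var z) (var x) = refl
pairOf-comm (var z) (var y) = refl
pairOf-comm (var z) (var z) = refl

pairOf-ends : ∀ w w' → w ≢ w' →
  (fstP (pairOf w w') ≡ w × sndP (pairOf w w') ≡ w') ⊎ (fstP (pairOf w w') ≡ w' × sndP (pairOf w w') ≡ w)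
pairOf-ends tmin    tmin    w≢w = ⊥-elim (w≢w refl)
pairOf-ends tmin    tmax      _ = inj₁ (refl , refl)
pairOf-ends tmin    (var x)   _ = inj₁ (refl , refl)
pairOf-ends tmin    (var y)   _ = inj₁ (refl , refl)
pairOf-ends tmin    (var z)   _ = inj₁ (refl , refl)
pairOf-ends tmax    tmin      _ = inj₂ (refl , refl)
pairOf-ends tmax    tmax    w≢w = ⊥-elim (w≢w refl)
pairOf-ends tmax    (var x)   _ = inj₁ (refl , refl)
pairOf-ends tmax    (var y)   _ = inj₁ (refl , refl)
pairOf-ends tmax    (var z)   _ = inj₁ (refl , refl)
pairOf-ends (var x) tmin      _ = inj₂ (refl , refl)
pairOf-ends (var x) tmax      _ = inj₂ (refl , refl)
pairOf-ends (var x) (var x) w≢w = ⊥-elim (w≢w refl)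
pairOf-ends (var x) (var y)   _ = inj₁ (refl , refl)
pairOf-ends (var x) (var z)   _ = inj₁ (refl , refl)
pairOf-ends (var y) tmin      _ = inj₂ (refl , refl)
pairOf-ends (var y) tmax      _ = inj₂ (refl , refl)
pairOf-ends (var y) (var x)   _ = inj₂ (refl , refl)
pairOf-ends (var y) (var y) w≢w = ⊥-elim (w≢w refl)
pairOf-ends (var y) (var z)   _ = inj₁ (refl , refl)
pairOf-ends (var z) tmin      _ = inj₂ (refl , refl)
pairOf-ends (var z) tmax      _ = inj₂ (refl , refl)
pairOf-ends (var z) (var x)   _ = inj₂ (refl , refl)
pairOf-ends (var z) (var y)   _ = inj₂ (refl , refl)
pairOf-ends (var z) (var z) w≢w = ⊥-elim (w≢w refl)

update-same : ∀ α v n → update α v n v ≡ n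
update-same α x n = refl
update-same α y n = refl
update-same α z n = refl

update-other : ∀ α {v u} n → var u ≢ var v → update α v n u ≡ α u
update-other α {x} {x} n u≢v = ⊥-elim (u≢v refl)
update-other α {y} {y} n u≢v = ⊥-elim (u≢v refl)
update-other α {z} {z} n u≢v = ⊥-elim (u≢v refl)
update-other α {x} {y} n _   = refl
update-other α {x} {z} n _   = refl
update-other α {y} {x} n _   = refl
update-other α {y} {z} n _   = refl
update-other α {z} {x} n _   = refl
update-other α {z} {y} n _   = refl

assign : (I : Interp) → Var → (n : ℕ) → n ≤ N I → Interp
assign I v n n≤N = mkInterp (N I) (update (α I) v n) bounded
  where
  bounded : ∀ u → update (α I) v n u ≤ N I
  bounded u with v ≟V u
  ... | true  = n≤N
  ... | false = α≤N I u

valI-assign-var : ∀ I v {n} (n≤N : n ≤ N I) → valI (assign I v n n≤N) (var v) ≡ n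
valI-assign-var I v n≤N = update-same (α I) v _

valI-assign-other : ∀ I v {n} (n≤N : n ≤ N I) {w} → w ≢ var v → valI (assign I v n n≤N) w ≡ valI I w
valI-assign-other I v n≤N {tmin}  _   = refl
valI-assign-other I v n≤N {tmax}  _   = refl
valI-assign-other I v n≤N {var u} u≢v = update-other (α I) _ u≢v

gap : Interp → Term → Term → ℤ
gap I w w' = diff (valI I w) (valI I w')

gap-assign-var : ∀ I v {n} (n≤N : n ≤ N I) {w} → w ≢ var v → gap (assign I v n n≤N) w (var v) ≡ diff (valI I w) n
gap-assign-var I v n≤N w≢v = cong₂ diff (valI-assign-other I v n≤N w≢v) (valI-assign-var I v n≤N)

gap-assign-other : ∀ I v {n} (n≤N : n ≤ N I) {w w'} → w ≢ var v → w' ≢ var v →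
  gap (assign I v n n≤N) w w' ≡ gap I w w'
gap-assign-other I v n≤N w≢v w'≢v = cong₂ diff (valI-assign-other I v n≤N w≢v) (valI-assign-other I v n≤N w'≢v)

record Similar (δ : PotSep) (I J : Interp) : Set where
  constructor mkSimilar
  field
    pairwise : ∀ {w w'} → w ≢ w' → 1 ≤ δ (pairOf w w') → Agree (δ (pairOf w w')) (gap I w w') (gap J w w')

open Similar

Similar-sym : ∀ {δ I J} → Similar δ I J → Similar δ J I
Similar-sym sim = mkSimilar λ w≢w' 1≤δ → Agree-sym (pairwise sim w≢w' 1≤δ)

Similar-mono : ∀ {δ δ' I J} → (∀ p → δ p ≤ δ' p) → Similar δ' I J → Similar δ I J
Similar-mono δ≤δ' sim = mkSimilar λ {w} {w'} w≢w' 1≤δ →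
  Agree-mono (δ≤δ' (pairOf w w')) (pairwise sim w≢w' (ℕ.≤-trans 1≤δ (δ≤δ' (pairOf w w'))))

-- The raised threshold leaves exactly the room OnePointExtension needs for a new point for v.
hideTerms : Var → PotSep → Term → Term → ℕ
hideTerms v δ w w' with w ≟T var v | w' ≟T var v
... | no _ | no _ = δ (pairOf w w') ⊔ suc (δ (pairOf w (var v)) + δ (pairOf w' (var v)))
... | _    | _    = 0

hide : Var → PotSep → PotSep
hide v δ p = hideTerms v δ (fstP p) (sndP p)

module _ (v : Var) (δ : PotSep) where

  hideTerms-other : ∀ {w w'} → w ≢ var v → w' ≢ var v →
    hideTerms v δ w w' ≡ δ (pairOf w w') ⊔ suc (δ (pairOf w (var v)) + δ (pairOf w' (var v)))
  hideTerms-other {w} {w'} w≢v w'≢v with w ≟T var v | w' ≟T var v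
  ... | yes w≡v | _        = ⊥-elim (w≢v w≡v)
  ... | no _    | yes w'≡v = ⊥-elim (w'≢v w'≡v)
  ... | no _    | no _     = refl

  hideTerms-varʳ : ∀ w → hideTerms v δ w (var v) ≡ 0
  hideTerms-varʳ w with w ≟T var v | var v ≟T var v
  ... | yes _ | _       = refl
  ... | no _  | yes _   = refl
  ... | no _  | no v≢v  = ⊥-elim (v≢v refl)

  hideTerms-varˡ : ∀ w → hideTerms v δ (var v) w ≡ 0
  hideTerms-varˡ w with var v ≟T var v
  ... | yes _  = refl
  ... | no v≢v = ⊥-elim (v≢v refl)

  hide-pairOf : ∀ {w w'} → w ≢ w' → w ≢ var v → w' ≢ var v →
    hide v δ (pairOf w w') ≡ δ (pairOf w w') ⊔ suc (δ (pairOf w (var v)) + δ (pairOf w' (var v)))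
  hide-pairOf {w} {w'} w≢w' w≢v w'≢v with pairOf-ends w w' w≢w'
  ... | inj₁ (fst≡w , snd≡w') = trans (cong₂ (hideTerms v δ) fst≡w snd≡w') (hideTerms-other w≢v w'≢v)
  ... | inj₂ (fst≡w' , snd≡w) = begin
    hideTerms v δ (fstP (pairOf w w')) (sndP (pairOf w w'))
      ≡⟨ cong₂ (hideTerms v δ) fst≡w' snd≡w ⟩
    hideTerms v δ w' w
      ≡⟨ hideTerms-other w'≢v w≢v ⟩
    δ (pairOf w' w) ⊔ suc (δ (pairOf w' (var v)) + δ (pairOf w (var v)))
      ≡⟨ cong₂ (λ p n → δ p ⊔ suc n) (pairOf-comm w' w) (ℕ.+-comm (δ (pairOf w' (var v))) _) ⟩
    δ (pairOf w w') ⊔ suc (δ (pairOf w (var v)) + δ (pairOf w' (var v)))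
      ∎
    where open ≡-Reasoning

  hide-var : ∀ {w} → w ≢ var v → hide v δ (pairOf w (var v)) ≡ 0
  hide-var {w} w≢v with pairOf-ends w (var v) w≢v
  ... | inj₁ (fst≡w , snd≡v) = trans (cong₂ (hideTerms v δ) fst≡w snd≡v) (hideTerms-varʳ w)
  ... | inj₂ (fst≡v , snd≡w) = trans (cong₂ (hideTerms v δ) fst≡v snd≡w) (hideTerms-varˡ w)

module _ (v : Var) (δ : PotSep) {I J : Interp} (sim : Similar (hide v δ) I J) where

  private
    others : List Term
    others = filter (λ w → ¬? (w ≟T var v)) allTerms

    ∈-others : ∀ {w} → w ≢ var v → w ∈ others
    ∈-others w≢v = ∈-filter⁺ (λ w → ¬? (w ≟T var v)) (∈-allTerms _) w≢v

    others-≢ : ∀ {w} → w ∈ others → w ≢ var v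
    others-≢ w∈ = proj₂ (∈-filter⁻ (λ w → ¬? (w ≟T var v)) {xs = allTerms} w∈)

    radius : Term → ℕ
    radius w = δ (pairOf w (var v))

    similar-hidden : ∀ {w w'} → w ≢ w' → w ≢ var v → w' ≢ var v →
      Agree (δ (pairOf w w') ⊔ suc (radius w + radius w')) (gap I w w') (gap J w w')
    similar-hidden {w} {w'} w≢w' w≢v w'≢v =
      subst (λ t → Agree t _ _) hidden
        (pairwise sim w≢w' (subst (1 ≤_) (sym hidden) (ℕ.≤-trans (s≤s z≤n) (ℕ.m≤n⊔m _ _))))
      where
      hidden : hide v δ (pairOf w w') ≡ δ (pairOf w w') ⊔ suc (radius w + radius w')
      hidden = hide-pairOf v δ w≢w' w≢v w'≢v

    agree : ∀ {w w'} → w ∈ others → w' ∈ others → Agree (suc (radius w + radius w')) (gap I w w') (gap J w w')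
    agree {w} {w'} w∈ w'∈ with w ≟T w'
    ... | yes refl = Agree-self _ (valI I w) (valI J w)
    ... | no w≢w'  = Agree-mono (ℕ.m≤n⊔m _ _) (similar-hidden w≢w' (others-≢ w∈) (others-≢ w'∈))

  Similar-assign : ∀ {n m} (n≤N : n ≤ N I) (m≤N : m ≤ N J) →
    (∀ {w} → w ≢ var v → Agree (radius w) (diff (valI I w) n) (diff (valI J w) m)) →
    Similar δ (assign I v n n≤N) (assign J v m m≤N)
  Similar-assign {n} {m} n≤N m≤N new = mkSimilar pairs
    where
    I' = assign I v n n≤N
    J' = assign J v m m≤N
    to-new : ∀ {w} → w ≢ var v → Agree (radius w) (gap I' w (var v)) (gap J' w (var v))
    to-new w≢v = subst₂ (Agree _) (sym (gap-assign-var I v n≤N w≢v)) (sym (gap-assign-var J v m≤N w≢v)) (new w≢v)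
    pairs : ∀ {w w'} → w ≢ w' → 1 ≤ δ (pairOf w w') → Agree (δ (pairOf w w')) (gap I' w w') (gap J' w w')
    pairs {w} {w'} w≢w' _ with w ≟T var v | w' ≟T var v
    ... | yes refl | yes refl = ⊥-elim (w≢w' refl)
    ... | no w≢v   | yes refl = to-new w≢v
    ... | yes refl | no w'≢v  = subst (λ p → Agree (δ p) (gap I' (var v) w') (gap J' (var v) w')) (pairOf-comm w' (var v))
                                  (Agree-swap (valI I' w') (valI I' (var v)) (valI J' w') (valI J' (var v)) (to-new w'≢v))
    ... | no w≢v   | no w'≢v  = subst₂ (Agree _)
                                  (sym (gap-assign-other I v n≤N w≢v w'≢v)) (sym (gap-assign-other J v m≤N w≢v w'≢v))
                                  (Agree-mono (ℕ.m≤m⊔n _ _) (similar-hidden w≢w' w≢v w'≢v))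

  similar-extend : ∀ n (n≤N : n ≤ N I) → ∃[ m ] Σ (m ≤ N J) λ m≤N → Similar δ (assign I v n n≤N) (assign J v m m≤N)
  similar-extend n n≤N = ∣ q ∣ , ∣q∣≤N ,
    Similar-assign n≤N ∣q∣≤N λ w≢v → subst (Agree _ _) (cong (λ i → + _ ℤ.- i) (sym +∣q∣≡q)) (new-point w≢v)
    where
    open OnePointExtension (λ w → + valI I w) (λ w → + valI J w) radius others agree (+ n) (∈-others {tmin} (λ ())) (+≤+ z≤n)
    q : ℤ
    q = proj₁ extension
    new-point : ∀ {w} → w ≢ var v → Agree (radius w) (diff (valI I w) n) (+ valI J w ℤ.- q)
    new-point w≢v = proj₂ extension (∈-others w≢v)
    0≤q : + 0 ℤ.≤ q
    0≤q = ℤ.i-j≤0⇒i≤j {+ 0} (Agree-nonpos (new-point {tmin} (λ ())) (ℤ.i≤j⇒i-j≤0 {+ 0} {+ n} (+≤+ z≤n)))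
    +∣q∣≡q : + ∣ q ∣ ≡ q
    +∣q∣≡q = ℤ.0≤i⇒+∣i∣≡i 0≤q
    ∣q∣≤N : ∣ q ∣ ≤ N J
    ∣q∣≤N = ℤ.drop‿+≤+ (subst (ℤ._≤ + N J) (sym +∣q∣≡q)
              (ℤ.0≤i-j⇒j≤i (Agree-nonneg (new-point {tmax} (λ ())) (ℤ.i≤j⇒0≤j-i (+≤+ n≤N)))))

allPairs : List Pair
allPairs = p-min-max ∷ p-min-x ∷ p-min-y ∷ p-min-z ∷ p-max-x ∷ p-max-y ∷ p-max-z ∷ p-x-y ∷ p-x-z ∷ p-y-z ∷ []

∈-allPairs : ∀ p → p ∈ allPairs
∈-allPairs p-min-max = here refl
∈-allPairs p-min-x   = there (here refl)
∈-allPairs p-min-y   = there (there (here refl))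
∈-allPairs p-min-z   = there (there (there (here refl)))
∈-allPairs p-max-x   = there (there (there (there (here refl))))
∈-allPairs p-max-y   = there (there (there (there (there (here refl)))))
∈-allPairs p-max-z   = there (there (there (there (there (there (here refl))))))
∈-allPairs p-x-y     = there (there (there (there (there (there (there (here refl)))))))
∈-allPairs p-x-z     = there (there (there (there (there (there (there (there (here refl))))))))
∈-allPairs p-y-z     = there (there (there (there (there (there (there (there (there (here refl)))))))))

for-allPairs : ∀ (P : Pair → Set) (P? : ∀ p → Dec (P p)) {ok : True (all? P? allPairs)} → ∀ p → P p
for-allPairs P P? {ok} p = All.lookup (toWitness ok) (∈-allPairs p)

single : Pair → PotSep
single p-min-max p-min-max = 1
single p-min-x   p-min-x   = 1
single p-min-y   p-min-y   = 1
single p-min-z   p-min-z   = 1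
single p-max-x   p-max-x   = 1
single p-max-y   p-max-y   = 1
single p-max-z   p-max-z   = 1
single p-x-y     p-x-y     = 1
single p-x-z     p-x-z     = 1
single p-y-z     p-y-z     = 1
single _         _         = 0

single-self : ∀ p → 1 ≤ single p p
single-self = for-allPairs (λ p → 1 ≤ single p p) (λ p → 1 ℕ.≤? single p p)

_⊕_ : PotSep → PotSep → PotSep
(δ₁ ⊕ δ₂) p = δ₁ p + δ₂ p

sepOf : Formula → PotSep
sepOf (atom _ u u') = single (pairOf u u')
sepOf (¬' φ)        = sepOf φ
sepOf (φ ∨' ψ)      = sepOf φ ⊕ sepOf ψ
sepOf (φ ∧' ψ)      = sepOf φ ⊕ sepOf ψ
sepOf (∃' v φ)      = hide v (sepOf φ)
sepOf (∀' v φ)      = hide v (sepOf φ)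

T-ext : ∀ {b b'} → (T b → T b') → (T b' → T b) → b ≡ b'
T-ext {true}  {true}  _ _ = refl
T-ext {true}  {false} f _ = ⊥-elim (f _)
T-ext {false} {true}  _ g = ⊥-elim (g _)
T-ext {false} {false} _ _ = refl

module _ (p : ℕ → Bool) (K : ℕ) where

  any-upTo⁻ : T (any p (upTo K)) → ∃[ n ] n ℕ.< K × T (p n)
  any-upTo⁻ h with n , n∈ , pn ← find (Any.any⁻ p (upTo K) h) = n , ∈-upTo⁻ n∈ , pn

  any-upTo⁺ : ∀ {n} → n ℕ.< K → T (p n) → T (any p (upTo K))
  any-upTo⁺ n<K pn = Any.any⁺ p (lose (∈-upTo⁺ n<K) pn)

  all-upTo⁻ : T (all p (upTo K)) → ∀ {n} → n ℕ.< K → T (p n)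
  all-upTo⁻ h n<K = All.lookup (All.all⁺ p (upTo K) h) (∈-upTo⁺ n<K)

  all-upTo⁺ : (∀ {n} → n ℕ.< K → T (p n)) → T (all p (upTo K))
  all-upTo⁺ h = All.all⁻ p (All.tabulate (λ n∈ → h (∈-upTo⁻ n∈)))

holdsAt : Interp → Var → Formula → ℕ → Bool
holdsAt I v φ n = eval (N I) (update (α I) v n) φ

⊨-similar : ∀ φ {I J} → Similar (sepOf φ) I J → I ⊨ φ ≡ J ⊨ φ
⊨-similar (atom R u u') {I} {J} sim with u ≟T u'
... | yes refl  = relB-agree R (Agree-self 1 (valI I u) (valI J u))
... | no  u≢u' = relB-agree R (Agree-mono (single-self (pairOf u u')) (pairwise sim u≢u' (single-self (pairOf u u'))))
⊨-similar (¬' φ)   sim = cong not (⊨-similar φ sim)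
⊨-similar (φ ∨' ψ) sim = cong₂ _∨_ (⊨-similar φ (Similar-mono (λ p → ℕ.m≤m+n _ _) sim))
                                    (⊨-similar ψ (Similar-mono (λ p → ℕ.m≤n+m _ _) sim))
⊨-similar (φ ∧' ψ) sim = cong₂ _∧_ (⊨-similar φ (Similar-mono (λ p → ℕ.m≤m+n _ _) sim))
                                    (⊨-similar ψ (Similar-mono (λ p → ℕ.m≤n+m _ _) sim))
⊨-similar (∃' v φ) sim = T-ext (transfer sim) (transfer (Similar-sym sim))
  where
  transfer : ∀ {I J} → Similar (hide v (sepOf φ)) I J → T (I ⊨ ∃' v φ) → T (J ⊨ ∃' v φ)
  transfer {I} {J} sim I⊨ with n , n<K , I'⊨ ← any-upTo⁻ (holdsAt I v φ) (suc (N I)) I⊨ =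
    let m , m≤N , sim' = similar-extend v (sepOf φ) sim n (ℕ.s≤s⁻¹ n<K)
    in any-upTo⁺ (holdsAt J v φ) (suc (N J)) (s≤s m≤N) (subst T (⊨-similar φ sim') I'⊨)
⊨-similar (∀' v φ) sim = T-ext (transfer sim) (transfer (Similar-sym sim))
  where
  transfer : ∀ {I J} → Similar (hide v (sepOf φ)) I J → T (I ⊨ ∀' v φ) → T (J ⊨ ∀' v φ)
  transfer {I} {J} sim I⊨ = all-upTo⁺ (holdsAt J v φ) (suc (N J)) λ m<K →
    let n , n≤N , sim' = similar-extend v (sepOf φ) (Similar-sym sim) _ (ℕ.s≤s⁻¹ m<K)
    in subst T (sym (⊨-similar φ sim')) (all-upTo⁻ (holdsAt I v φ) (suc (N I)) I⊨ (s≤s n≤N))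

Agree-pairOf : ∀ {t} I J {w w'} → w ≢ w' →
  Agree t (gap I (fstP (pairOf w w')) (sndP (pairOf w w'))) (gap J (fstP (pairOf w w')) (sndP (pairOf w w'))) →
  Agree t (gap I w w') (gap J w w')
Agree-pairOf I J {w} {w'} w≢w' a with pairOf-ends w w' w≢w'
... | inj₁ (fst≡w , snd≡w') rewrite fst≡w | snd≡w' = a
... | inj₂ (fst≡w' , snd≡w) rewrite fst≡w' | snd≡w =
  Agree-swap (valI I w') (valI I w) (valI J w') (valI J w) a

distinguishes? : ∀ δ I J p → Dec (Distinguishes δ I J p)
distinguishes? δ I J p = (1 ℕ.≤? δ p) ×-dec
  Separated? (δ p) (valI I (fstP p)) (valI I (sndP p)) (valI J (fstP p)) (valI J (sndP p))

Similar-unless-distinguished : ∀ {δ I J} → (∀ p → ¬ Distinguishes δ I J p) → Similar δ I J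
Similar-unless-distinguished {δ} {I} {J} nd = mkSimilar λ {w} {w'} w≢w' 1≤δ →
  let p = pairOf w w' in
  Agree-pairOf I J w≢w' (Agree-unless-separated (δ p) (valI I (fstP p)) (valI I (sndP p)) (valI J (fstP p)) (valI J (sndP p))
    (λ sep → nd p (1≤δ , sep)))

separator-unless-similar : ∀ {A B : Interp → Set} {δ} → (∀ {I J} → A I → B J → ¬ Similar δ I J) → IsSeparator A B δ
separator-unless-similar {δ = δ} ¬sim I J aI bJ with any? (distinguishes? δ I J) allPairs
... | yes some = let p , _ , d = find some in p , d
... | no  none = ⊥-elim (¬sim aI bJ (Similar-unless-distinguished λ p d → none (lose (∈-allPairs p) d)))

endMax : Term → PotSep → ℕ
endMax e δ = δ (pairOf e (var x)) ⊔ δ (pairOf e (var y)) ⊔ δ (pairOf e (var z))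

≤endMax : ∀ e δ u → δ (pairOf e (var u)) ≤ endMax e δ
≤endMax e δ x = ℕ.≤-trans (ℕ.m≤m⊔n _ (δ (pairOf e (var y)))) (ℕ.m≤m⊔n _ _)
≤endMax e δ y = ℕ.≤-trans (ℕ.m≤n⊔m (δ (pairOf e (var x))) _) (ℕ.m≤m⊔n _ _)
≤endMax e δ z = ℕ.m≤n⊔m _ _

endMax-lub : ∀ e δ {k} → (∀ u → δ (pairOf e (var u)) ≤ k) → endMax e δ ≤ k
endMax-lub e δ h = ℕ.⊔-lub (ℕ.⊔-lub (h x) (h y)) (h z)

module _ (δ : PotSep) where

  c-xy-xz : δ p-x-y + δ p-x-z ≤ c δ
  c-xy-xz = ℕ.≤-trans (ℕ.m≤m⊔n _ (δ p-x-y + δ p-y-z)) (ℕ.m≤m⊔n _ _)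

  c-xy-yz : δ p-x-y + δ p-y-z ≤ c δ
  c-xy-yz = ℕ.≤-trans (ℕ.m≤n⊔m (δ p-x-y + δ p-x-z) _) (ℕ.m≤m⊔n _ _)

  c-xz-yz : δ p-x-z + δ p-y-z ≤ c δ
  c-xz-yz = ℕ.m≤n⊔m _ _

  xy≤c : δ p-x-y ≤ c δ
  xy≤c = ℕ.≤-trans (ℕ.m≤m+n _ _) c-xy-xz

  xz≤c : δ p-x-z ≤ c δ
  xz≤c = ℕ.≤-trans (ℕ.m≤m+n _ _) c-xz-yz

  yz≤c : δ p-y-z ≤ c δ
  yz≤c = ℕ.≤-trans (ℕ.m≤n+m _ _) c-xz-yz

  varPair≤c : ∀ {u u'} → var u ≢ var u' → δ (pairOf (var u) (var u')) ≤ c δ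
  varPair≤c {x} {x} u≢u' = ⊥-elim (u≢u' refl)
  varPair≤c {y} {y} u≢u' = ⊥-elim (u≢u' refl)
  varPair≤c {z} {z} u≢u' = ⊥-elim (u≢u' refl)
  varPair≤c {x} {y} _ = xy≤c
  varPair≤c {y} {x} _ = xy≤c
  varPair≤c {x} {z} _ = xz≤c
  varPair≤c {z} {x} _ = xz≤c
  varPair≤c {y} {z} _ = yz≤c
  varPair≤c {z} {y} _ = yz≤c

  hidden≤ : ∀ p q r → δ p ≤ c δ → δ q + δ r ≤ c δ → δ p ⊔ suc (δ q + δ r) ≤ suc (c δ)
  hidden≤ p q r p≤c qr≤c = ℕ.⊔-lub (ℕ.≤-trans p≤c (ℕ.n≤1+n _)) (s≤s qr≤c)

  c-hide : ∀ v → c (hide v δ) ≤ suc (c δ)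
  c-hide x = ℕ.⊔-lub (ℕ.⊔-lub z≤n hidden-yz) hidden-yz
    where
    hidden-yz : δ p-y-z ⊔ suc (δ p-x-y + δ p-x-z) ≤ suc (c δ)
    hidden-yz = hidden≤ p-y-z p-x-y p-x-z yz≤c c-xy-xz
  c-hide y = ℕ.⊔-lub (ℕ.⊔-lub hidden-xz z≤n) (ℕ.≤-trans (ℕ.≤-reflexive (ℕ.+-identityʳ _)) hidden-xz)
    where
    hidden-xz : δ p-x-z ⊔ suc (δ p-x-y + δ p-y-z) ≤ suc (c δ)
    hidden-xz = hidden≤ p-x-z p-x-y p-y-z xz≤c c-xy-yz
  c-hide z = ℕ.⊔-lub (ℕ.⊔-lub hidden-xy hidden-xy) z≤n
    where
    hidden-xy : δ p-x-y ⊔ suc (δ p-x-z + δ p-y-z) + 0 ≤ suc (c δ)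
    hidden-xy = ℕ.≤-trans (ℕ.≤-reflexive (ℕ.+-identityʳ _)) (hidden≤ p-x-y p-x-z p-y-z xy≤c c-xz-yz)

  endMax-hide : ∀ v {e} → (∀ u → e ≢ var u) → endMax e (hide v δ) ≤ suc (endMax e δ + c δ)
  endMax-hide v {e} e≢var = endMax-lub e (hide v δ) bound
    where
    bound : ∀ u → hide v δ (pairOf e (var u)) ≤ suc (endMax e δ + c δ)
    bound u with var u ≟T var v
    ... | yes refl = ℕ.≤-trans (ℕ.≤-reflexive (hide-var v δ (e≢var v))) z≤n
    ... | no u≢v = ℕ.≤-trans (ℕ.≤-reflexive (hide-pairOf v δ (e≢var u) (e≢var v) u≢v))
      (ℕ.⊔-lub (ℕ.≤-trans (≤endMax e δ u) (ℕ.≤-trans (ℕ.m≤m+n _ _) (ℕ.n≤1+n _)))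
               (s≤s (ℕ.+-mono-≤ (≤endMax e δ v) (varPair≤c u≢v))))

  pairMinMax-hide : ∀ v → hide v δ p-min-max ≤ suc (b δ)
  pairMinMax-hide v = ℕ.≤-trans (ℕ.≤-reflexive (hide-pairOf v δ {tmin} {tmax} (λ ()) (λ ()) (λ ())))
    (ℕ.⊔-lub (ℕ.≤-trans (ℕ.m≤m⊔n _ _) (ℕ.n≤1+n _))
             (s≤s (ℕ.≤-trans (ℕ.+-mono-≤ (≤endMax tmin δ v) (≤endMax tmax δ v)) (ℕ.m≤n⊔m _ _))))

  b-hide : ∀ v → b (hide v δ) ≤ b δ + 2 * suc (c δ)
  b-hide v = ℕ.⊔-lub (ℕ.≤-trans (pairMinMax-hide v) (ℕ.m<m+n (b δ) (s≤s z≤n))) (begin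
    endMax tmin (hide v δ) + endMax tmax (hide v δ)
      ≤⟨ ℕ.+-mono-≤ (endMax-hide v {tmin} (λ _ ())) (endMax-hide v {tmax} (λ _ ())) ⟩
    suc (endMax tmin δ + c δ) + suc (endMax tmax δ + c δ)
      ≡⟨ regroup (endMax tmin δ) (endMax tmax δ) (c δ) ⟩
    bMinMax δ + 2 * suc (c δ)
      ≤⟨ ℕ.+-monoˡ-≤ (2 * suc (c δ)) (ℕ.m≤n⊔m (δ p-min-max) _) ⟩
    b δ + 2 * suc (c δ)
      ∎)
    where
    open ℕ.≤-Reasoning
    regroup : ∀ l l' k → suc (l + k) + suc (l' + k) ≡ (l + l') + 2 * suc k
    regroup = solve-∀

module _ (δ₁ δ₂ : PotSep) where

  c-⊕ : c (δ₁ ⊕ δ₂) ≤ c δ₁ + c δ₂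
  c-⊕ = ℕ.⊔-lub (ℕ.⊔-lub (split p-x-y p-x-z (c-xy-xz δ₁) (c-xy-xz δ₂)) (split p-x-y p-y-z (c-xy-yz δ₁) (c-xy-yz δ₂)))
                (split p-x-z p-y-z (c-xz-yz δ₁) (c-xz-yz δ₂))
    where
    split : ∀ p q → δ₁ p + δ₁ q ≤ c δ₁ → δ₂ p + δ₂ q ≤ c δ₂ →
      (δ₁ ⊕ δ₂) p + (δ₁ ⊕ δ₂) q ≤ c δ₁ + c δ₂
    split p q ≤c₁ ≤c₂ =
      ℕ.≤-trans (ℕ.≤-reflexive (interchange (δ₁ p) (δ₂ p) (δ₁ q) (δ₂ q))) (ℕ.+-mono-≤ ≤c₁ ≤c₂)

  endMax-⊕ : ∀ e → endMax e (δ₁ ⊕ δ₂) ≤ endMax e δ₁ + endMax e δ₂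
  endMax-⊕ e = endMax-lub e (δ₁ ⊕ δ₂) λ u → ℕ.+-mono-≤ (≤endMax e δ₁ u) (≤endMax e δ₂ u)

  b-⊕ : b (δ₁ ⊕ δ₂) ≤ b δ₁ + b δ₂
  b-⊕ = ℕ.⊔-lub (ℕ.+-mono-≤ (ℕ.m≤m⊔n (δ₁ p-min-max) (bMinMax δ₁)) (ℕ.m≤m⊔n (δ₂ p-min-max) (bMinMax δ₂)))
    (begin
    endMax tmin (δ₁ ⊕ δ₂) + endMax tmax (δ₁ ⊕ δ₂)
      ≤⟨ ℕ.+-mono-≤ (endMax-⊕ tmin) (endMax-⊕ tmax) ⟩
    (endMax tmin δ₁ + endMax tmin δ₂) + (endMax tmax δ₁ + endMax tmax δ₂)
      ≡⟨ interchange (endMax tmin δ₁) _ _ _ ⟩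
    bMinMax δ₁ + bMinMax δ₂
      ≤⟨ ℕ.+-mono-≤ (ℕ.m≤n⊔m (δ₁ p-min-max) _) (ℕ.m≤n⊔m (δ₂ p-min-max) _) ⟩
    b δ₁ + b δ₂
      ∎)
    where open ℕ.≤-Reasoning

c-single : ∀ p → c (single p) ≤ 1
c-single = for-allPairs (λ p → c (single p) ≤ 1) (λ p → c (single p) ℕ.≤? 1)

b-single : ∀ p → b (single p) ≤ 2
b-single = for-allPairs (λ p → b (single p) ≤ 2) (λ p → b (single p) ℕ.≤? 2)

c-sepOf : ∀ φ → c (sepOf φ) ≤ size φ
c-sepOf (atom _ u u') = c-single (pairOf u u')
c-sepOf (¬' φ)        = ℕ.m≤n⇒m≤1+n (c-sepOf φ)
c-sepOf (φ ∨' ψ)      = ℕ.m≤n⇒m≤1+n (ℕ.≤-trans (c-⊕ (sepOf φ) (sepOf ψ)) (ℕ.+-mono-≤ (c-sepOf φ) (c-sepOf ψ)))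
c-sepOf (φ ∧' ψ)      = ℕ.m≤n⇒m≤1+n (ℕ.≤-trans (c-⊕ (sepOf φ) (sepOf ψ)) (ℕ.+-mono-≤ (c-sepOf φ) (c-sepOf ψ)))
c-sepOf (∃' v φ)      = ℕ.≤-trans (c-hide (sepOf φ) v) (s≤s (c-sepOf φ))
c-sepOf (∀' v φ)      = ℕ.≤-trans (c-hide (sepOf φ) v) (s≤s (c-sepOf φ))

twiceSquare : ℕ → ℕ
twiceSquare n = 2 * (n * n)

twiceSquare-mono : ∀ {m n} → m ≤ n → twiceSquare m ≤ twiceSquare n
twiceSquare-mono m≤n = ℕ.*-monoʳ-≤ 2 (ℕ.*-mono-≤ m≤n m≤n)

twiceSquare-+ : ∀ m n → twiceSquare m + twiceSquare n ≤ twiceSquare (suc (m + n))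
twiceSquare-+ m n = ℕ.≤-trans (ℕ.m≤m+n _ (2 + 4 * m + 4 * n + 4 * (m * n))) (ℕ.≤-reflexive (expand m n))
  where
  expand : ∀ m n → 2 * (m * m) + 2 * (n * n) + (2 + 4 * m + 4 * n + 4 * (m * n)) ≡ 2 * (suc (m + n) * suc (m + n))
  expand = solve-∀

twiceSquare-suc : ∀ n → twiceSquare n + 2 * suc n ≤ twiceSquare (suc n)
twiceSquare-suc n = ℕ.≤-trans (ℕ.m≤m+n _ (2 * n)) (ℕ.≤-reflexive (expand n))
  where
  expand : ∀ n → 2 * (n * n) + 2 * suc n + 2 * n ≡ 2 * (suc n * suc n)
  expand = solve-∀

b-sepOf-quantified : ∀ v φ → b (sepOf φ) ≤ twiceSquare (size φ) → b (hide v (sepOf φ)) ≤ twiceSquare (suc (size φ))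
b-sepOf-quantified v φ b≤ = ℕ.≤-trans (b-hide (sepOf φ) v)
  (ℕ.≤-trans (ℕ.+-mono-≤ b≤ (ℕ.*-monoʳ-≤ 2 (s≤s (c-sepOf φ)))) (twiceSquare-suc (size φ)))

b-sepOf : ∀ φ → b (sepOf φ) ≤ twiceSquare (size φ)
b-sepOf (atom _ u u') = b-single (pairOf u u')
b-sepOf (¬' φ)        = ℕ.≤-trans (b-sepOf φ) (twiceSquare-mono (ℕ.n≤1+n (size φ)))
b-sepOf (φ ∨' ψ)      = ℕ.≤-trans (b-⊕ (sepOf φ) (sepOf ψ))
                          (ℕ.≤-trans (ℕ.+-mono-≤ (b-sepOf φ) (b-sepOf ψ)) (twiceSquare-+ (size φ) (size ψ)))
b-sepOf (φ ∧' ψ)      = ℕ.≤-trans (b-⊕ (sepOf φ) (sepOf ψ))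
                          (ℕ.≤-trans (ℕ.+-mono-≤ (b-sepOf φ) (b-sepOf ψ)) (twiceSquare-+ (size φ) (size ψ)))
b-sepOf (∃' v φ)      = b-sepOf-quantified v φ (b-sepOf φ)
b-sepOf (∀' v φ)      = b-sepOf-quantified v φ (b-sepOf φ)

weight²-sepOf : ∀ φ → weight² (sepOf φ) ≤ (2 * size φ) * (2 * size φ)
weight²-sepOf φ = ℕ.≤-trans (ℕ.+-mono-≤ (ℕ.*-mono-≤ (c-sepOf φ) (c-sepOf φ)) (b-sepOf φ))
  (ℕ.≤-trans (ℕ.m≤m+n (size φ * size φ + twiceSquare (size φ)) (size φ * size φ)) (ℕ.≤-reflexive (expand (size φ))))
  where
  expand : ∀ s → s * s + 2 * (s * s) + s * s ≡ (2 * s) * (2 * s)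
  expand = solve-∀

sepOf-separates : ∀ ψ {A B : Interp → Set} →
  (∀ I → A I → I ⊨ ψ ≡ true) → (∀ I → B I → I ⊨ ψ ≡ false) → IsSeparator A B (sepOf ψ)
sepOf-separates ψ A⊨ψ B⊭ψ = separator-unless-similar λ {I} {J} aI bJ sim →
  true≢false (trans (sym (A⊨ψ I aI)) (trans (⊨-similar ψ sim) (B⊭ψ J bJ)))
  where
  true≢false : true ≢ false
  true≢false ()

theorem3p6 : (ψ : Formula) (A B : Interp → Set)
    → (∀ I → A I → I ⊨ ψ ≡ true)
    → (∀ I → B I → I ⊨ ψ ≡ false)
    → (δ : PotSep) → IsMinimalSeparator A B δ
    → weight² δ ≤ (2 * size ψ) * (2 * size ψ)
theorem3p6 ψ A B A⊨ψ B⊭ψ δ (_ , minimal) =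
  ℕ.≤-trans (minimal (sepOf ψ) (sepOf-separates ψ A⊨ψ B⊭ψ)) (weight²-sepOf ψ)
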